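{- For every $\ell$ there is $s=s(\ell)$ such that the following holds. If $G$ is a graph, $C\subseteq G$ is an $s$-blob cycle, and $v\notin V(C)$ has at least $|V(C)|/2-\ell$ neighbours on $C$, then there exists an $s'$-blob cycle $C'\subseteq G$ with $s'\ge s-2$, $V(C')=\{v\}\cup V(C)$, and the blob of $C'$ contained in the blob of $C$.
   Context: An $s$-blob cycle is the union of a cycle with a clique on $s$ consecutive vertices of that cycle; this set of $s$ clique vertices is called the blob. -}

module Defs where

open import Data.Nat using (ℕ; suc; _+_; _*_; _∸_; _≤_; _<_)
open import Data.Fin using (Fin; toℕ)
open import Data.Bool using (Bool; true; false)
open import Data.List using (length; filterᵇ; allFin)
open import Data.Product using (Σ; ∃; _×_; _,_)
open import Data.Sum using (_⊎_)
open import Relation.Binary.PropositionalEquality using (_≡_; _≢_)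
open import Function.Definitions using (Injective)

record Graph : Set where
  field
    n      : ℕ
    adj    : Fin n → Fin n → Bool
    sym    : ∀ u w → adj u w ≡ adj w u
    irrefl : ∀ u → adj u u ≡ false

open Graph public

Vertex : Graph → Set
Vertex G = Fin (n G)

Adj : (G : Graph) → Vertex G → Vertex G → Set
Adj G u w = adj G u w ≡ true

Consecutive : {k : ℕ} → Fin k → Fin k → Set
Consecutive {k} i j = (suc (toℕ i) ≡ toℕ j) ⊎ ((toℕ i ≡ k ∸ 1) × (toℕ j ≡ 0))

-- An s-blob cycle of length k in G: a cycle v_0 v_1 ... v_{k-1} v_0 of G
-- (k ≥ 3 distinct vertices, consecutive ones adjacent in G) such that the
-- s consecutive vertices v_0, ..., v_{s-1} (the blob) form a clique in G.
-- (Any s consecutive vertices of a cycle can be rotated to positions 0..s-1.)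
record BlobCycle (G : Graph) (k s : ℕ) : Set where
  field
    vtx      : Fin k → Vertex G
    vtx-inj  : Injective _≡_ _≡_ vtx
    length≥3 : 3 ≤ k
    cycle    : ∀ i j → Consecutive i j → Adj G (vtx i) (vtx j)
    blob≤k   : s ≤ k
    clique   : ∀ i j → toℕ i < s → toℕ j < s → i ≢ j → Adj G (vtx i) (vtx j)

open BlobCycle public

InCycle : {G : Graph} {k s : ℕ} → BlobCycle G k s → Vertex G → Set
InCycle {k = k} C u = Σ (Fin k) λ i → vtx C i ≡ u

InBlob : {G : Graph} {k s : ℕ} → BlobCycle G k s → Vertex G → Set
InBlob {k = k} {s} C u = Σ (Fin k) λ i → (toℕ i < s) × (vtx C i ≡ u)

-- Number of neighbours of v on C (C has distinct vertices, so count positions).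
nbrsOn : {G : Graph} {k s : ℕ} → BlobCycle G k s → Vertex G → ℕ
nbrsOn {G} {k} C v = length (filterᵇ (λ i → adj G v (vtx C i)) (allFin k))

-- Place the blob at positions 0, …, s − 1 of the cycle, with s = 2ℓ + 6.  If v has two neighbours
-- among the interior blob positions 1, …, s − 2, permute the interior (the blob is a clique, so
-- every cycle edge survives) to bring them to positions s − 3 and s − 2, and insert v between
-- them; positions 0, …, s − 3 then form the new blob, inside the old one.  Otherwise v has at most
-- one interior neighbour, and the arc s − 1, …, k − 1, 0 of k − s + 2 vertices must contain two
-- consecutive neighbours of v: else v would have at most (k − s + 3)/2 neighbours there, too few
-- in total.  Inserting v between these two keeps the whole blob.
module Submission where

open import Defs
open import Data.Bool using (Bool; true; false)
open import Data.Empty using (⊥-elim)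
open import Data.Fin as Fin using (Fin; toℕ; fromℕ<)
open import Data.Fin.Properties using (toℕ<n; toℕ-injective; toℕ-fromℕ<)
open import Data.List using (length; filterᵇ; tabulate)
open import Data.Nat using (ℕ; zero; suc; _+_; _*_; _∸_; _≤_; _<_; z≤n; s≤s; z<s; _≟_; _<?_; _%_)
open import Data.Nat.DivMod using (m<n⇒m%n≡m; n%n≡0; m%n<n)
open import Data.Nat.Properties
open import Data.Nat.Tactic.RingSolver using (solve-∀)
open import Data.Product using (Σ; ∃; _×_; _,_; proj₁; proj₂)
open import Data.Sum as Sum using (_⊎_; inj₁; inj₂)
open import Function using (_∘_)
open import Relation.Binary.PropositionalEquality as ≡
  using (_≡_; _≢_; refl; trans; cong; subst; subst₂)
open import Relation.Nullary using (¬_; yes; no)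
open import Relation.Unary using (Pred; _⊆_; _∪_; _≐_; _∉_)
open import Relation.Unary.Properties using (≐-trans)

private variable
  A : Set
  G : Graph
  k s : ℕ

Adj-sym : ∀ (G : Graph) {u w} → Adj G u w → Adj G w u
Adj-sym G {u} {w} u~w = trans (Graph.sym G w u) u~w

indicator : Bool → ℕ
indicator true  = 1
indicator false = 0

count : (ℕ → Bool) → ℕ → ℕ
count h zero    = 0
count h (suc n) = indicator (h 0) + count (h ∘ suc) n

count-+ : ∀ h m n → count h (m + n) ≡ count h m + count (λ i → h (m + i)) n
count-+ h zero    n = refl
count-+ h (suc m) n =
  trans (cong (indicator (h 0) +_) (count-+ (h ∘ suc) m n))
        (≡.sym (+-assoc (indicator (h 0)) (count (h ∘ suc) m) _))

count-snoc : ∀ h n → count h (suc n) ≡ count h n + indicator (h n)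
count-snoc h zero    = +-identityʳ _
count-snoc h (suc n) =
  trans (cong (indicator (h 0) +_) (count-snoc (h ∘ suc) n))
        (≡.sym (+-assoc (indicator (h 0)) (count (h ∘ suc) n) _))

length-filterᵇ-tabulate : ∀ {n} (p : A → Bool) (φ : Fin n → A) (h : ℕ → Bool) →
  (∀ i → h (toℕ i) ≡ p (φ i)) → length (filterᵇ p (tabulate φ)) ≡ count h n
length-filterᵇ-tabulate {n = zero}  p φ h h≗ = refl
length-filterᵇ-tabulate {n = suc n} p φ h h≗ rewrite h≗ Fin.zero with p (φ Fin.zero)
... | true  = cong suc (length-filterᵇ-tabulate p (φ ∘ Fin.suc) (h ∘ suc) (h≗ ∘ Fin.suc))
... | false = length-filterᵇ-tabulate p (φ ∘ Fin.suc) (h ∘ suc) (h≗ ∘ Fin.suc)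

TrueBelow : (ℕ → Bool) → ℕ → Set
TrueBelow h n = ∃ λ j → j < n × h j ≡ true

TwoTrueBelow : (ℕ → Bool) → ℕ → Set
TwoTrueBelow h n = ∃ λ i → ∃ λ j → i < j × j < n × h i ≡ true × h j ≡ true

AdjacentTrueBelow : (ℕ → Bool) → ℕ → Set
AdjacentTrueBelow h n = ∃ λ i → suc i < n × h i ≡ true × h (suc i) ≡ true

count≡0⊎trueBelow : ∀ h n → count h n ≡ 0 ⊎ TrueBelow h n
count≡0⊎trueBelow h zero = inj₁ refl
count≡0⊎trueBelow h (suc n) with h 0 in h0
... | true  = inj₂ (0 , z<s , h0)
... | false = Sum.map₂ (λ (j , j<n , hj) → suc j , s≤s j<n , hj) (count≡0⊎trueBelow (h ∘ suc) n)

twoTrue⊎count≤1 : ∀ h n → TwoTrueBelow h n ⊎ count h n ≤ 1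
twoTrue⊎count≤1 h zero = inj₂ z≤n
twoTrue⊎count≤1 h (suc n) with twoTrue⊎count≤1 (h ∘ suc) n
... | inj₁ (i , j , i<j , j<n , hi , hj) = inj₁ (suc i , suc j , s≤s i<j , s≤s j<n , hi , hj)
... | inj₂ tail≤1 with h 0 in h0
...   | false = inj₂ tail≤1
...   | true with count≡0⊎trueBelow (h ∘ suc) n
...     | inj₁ tail≡0         = inj₂ (s≤s (≤-reflexive tail≡0))
...     | inj₂ (j , j<n , hj) = inj₁ (0 , suc j , z<s , s≤s j<n , h0 , hj)

adjacentTrue-suc : ∀ {h n} → AdjacentTrueBelow (h ∘ suc) n → AdjacentTrueBelow h (suc n)
adjacentTrue-suc (i , i+1<n , hi , hi+1) = suc i , s≤s i+1<n , hi , hi+1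

adjacentTrue⊎sparse : ∀ h n → AdjacentTrueBelow h n ⊎ count h n + count h n ≤ suc n
adjacentTrue⊎sparse h zero = inj₂ z≤n
adjacentTrue⊎sparse h (suc zero) with h 0
... | true  = inj₂ ≤-refl
... | false = inj₂ z≤n
adjacentTrue⊎sparse h (suc (suc n))
  with adjacentTrue⊎sparse (h ∘ suc) (suc n) | adjacentTrue⊎sparse (h ∘ suc ∘ suc) n | h 0 in h0
... | from-1 | _ | false = Sum.map adjacentTrue-suc m≤n⇒m≤1+n from-1
... | _ | from-2 | true with h 1 in h1
...   | true  = inj₁ (0 , s≤s z<s , h0 , h1)
...   | false = Sum.map (adjacentTrue-suc ∘ adjacentTrue-suc) two-more from-2
  where
  two-more : ∀ {c} → c + c ≤ suc n → suc c + suc c ≤ suc (suc (suc n))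
  two-more {c} c+c≤ = s≤s (≤-trans (≤-reflexive (+-suc c c)) (s≤s c+c≤))

InjectiveBelow : ℕ → (ℕ → A) → Set
InjectiveBelow n f = ∀ {m m'} → m < n → m' < n → f m ≡ f m' → m ≡ m'

insertAt : ℕ → A → (ℕ → A) → ℕ → A
insertAt zero    x f zero    = x
insertAt zero    x f (suc m) = f m
insertAt (suc i) x f zero    = f zero
insertAt (suc i) x f (suc m) = insertAt i x (f ∘ suc) m

insertAt-< : ∀ {i m} (x : A) f → m < i → insertAt i x f m ≡ f m
insertAt-< {i = suc i} {zero}  x f _          = refl
insertAt-< {i = suc i} {suc m} x f (s≤s m<i) = insertAt-< x (f ∘ suc) m<i

insertAt-≡ : ∀ i (x : A) f → insertAt i x f i ≡ x
insertAt-≡ zero    x f = refl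
insertAt-≡ (suc i) x f = insertAt-≡ i x (f ∘ suc)

insertAt-> : ∀ {i m} (x : A) f → i ≤ m → insertAt i x f (suc m) ≡ f m
insertAt-> {i = zero}          x f _          = refl
insertAt-> {i = suc i} {suc m} x f (s≤s i≤m) = insertAt-> x (f ∘ suc) i≤m

insertAt-image : ∀ {k i m} (x : A) f → i ≤ k → m < suc k →
  insertAt i x f m ≡ x ⊎ ∃ λ j → j < k × insertAt i x f m ≡ f j
insertAt-image {i = zero}            {zero}  x f _ _         = inj₁ refl
insertAt-image {i = zero}            {suc m} x f _ (s≤s m<k) = inj₂ (m , m<k , refl)
insertAt-image {k = suc k} {suc i}   {zero}  x f _ _         = inj₂ (0 , z<s , refl)
insertAt-image {k = suc k} {suc i}   {suc m} x f (s≤s i≤k) (s≤s m<k+1) =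
  Sum.map₂ (λ (j , j<k , e) → suc j , s≤s j<k , e) (insertAt-image x (f ∘ suc) i≤k m<k+1)

insertAt-injective : ∀ {k i} {x : A} {f} → InjectiveBelow k f → (∀ {m} → m < k → f m ≢ x) →
  i ≤ k → InjectiveBelow (suc k) (insertAt i x f)
insertAt-injective {i = zero} f-inj x∉ _ {zero}  {zero}   _ _ _                   = refl
insertAt-injective {i = zero} f-inj x∉ _ {zero}  {suc m'} _ (s≤s m'<k) x≡         = ⊥-elim (x∉ m'<k (≡.sym x≡))
insertAt-injective {i = zero} f-inj x∉ _ {suc m} {zero}   (s≤s m<k) _ ≡x          = ⊥-elim (x∉ m<k ≡x)
insertAt-injective {i = zero} f-inj x∉ _ {suc m} {suc m'} (s≤s m<k) (s≤s m'<k) e = cong suc (f-inj m<k m'<k e)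
insertAt-injective {k = suc k} {suc i} {x} {f} f-inj x∉ (s≤s i≤k) = injective
  where
  fresh : ∀ {m} → m < suc k → f 0 ≢ insertAt i x (f ∘ suc) m
  fresh m< f0≡ with insertAt-image x (f ∘ suc) i≤k m<
  ... | inj₁ ≡x             = x∉ z<s (trans f0≡ ≡x)
  ... | inj₂ (j , j<k , ≡fj) = 0≢1+n (f-inj z<s (s≤s j<k) (trans f0≡ ≡fj))

  injective : InjectiveBelow (suc (suc k)) (insertAt (suc i) x f)
  injective {zero}  {zero}   _ _ _ = refl
  injective {zero}  {suc m'} _ (s≤s m'<) e = ⊥-elim (fresh m'< e)
  injective {suc m} {zero}   (s≤s m<) _ e = ⊥-elim (fresh m< (≡.sym e))
  injective {suc m} {suc m'} (s≤s m<) (s≤s m'<) e = cong suc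
    (insertAt-injective (λ a b e → suc-injective (f-inj (s≤s a) (s≤s b) e)) (x∉ ∘ s≤s) i≤k m< m'< e)

insertAt-step : (R : A → A → Set) {k a : ℕ} {x : A} {f : ℕ → A} →
  (∀ {m} → m < k → R (f m) (f (suc m))) → a < k → R (f a) x → R x (f (suc a)) →
  ∀ {m} → m < suc k → R (insertAt (suc a) x f m) (insertAt (suc a) x f (suc m))
insertAt-step R {a = zero} f-step _ fa~x x~fa+1 {zero}        _         = fa~x
insertAt-step R {a = zero} f-step _ fa~x x~fa+1 {suc zero}    _         = x~fa+1
insertAt-step R {a = zero} f-step _ fa~x x~fa+1 {suc (suc m)} (s≤s m<) = f-step m<
insertAt-step R {k = suc k} {suc a} f-step (s≤s a<k) fa~x x~fa+1 {zero}  _ = f-step z<s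
insertAt-step R {k = suc k} {suc a} f-step (s≤s a<k) fa~x x~fa+1 {suc m} (s≤s m<) =
  insertAt-step R (f-step ∘ s≤s) a<k fa~x x~fa+1 m<

transpose : ℕ → ℕ → ℕ → ℕ
transpose p q m with m ≟ p
... | yes _ = q
... | no _ with m ≟ q
...   | yes _ = p
...   | no _  = m

transpose-p : ∀ p q → transpose p q p ≡ q
transpose-p p q with p ≟ p
... | yes _   = refl
... | no p≢p = ⊥-elim (p≢p refl)

transpose-q : ∀ p q → transpose p q q ≡ p
transpose-q p q with q ≟ p
... | yes q≡p = q≡p
... | no _ with q ≟ q
...   | yes _   = refl
...   | no q≢q = ⊥-elim (q≢q refl)

transpose-fix : ∀ {p q m} → m ≢ p → m ≢ q → transpose p q m ≡ m
transpose-fix {p} {q} {m} m≢p m≢q with m ≟ p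
... | yes m≡p = ⊥-elim (m≢p m≡p)
... | no _ with m ≟ q
...   | yes m≡q = ⊥-elim (m≢q m≡q)
...   | no _    = refl

transpose-involutive : ∀ p q m → transpose p q (transpose p q m) ≡ m
transpose-involutive p q m with m ≟ p
... | yes refl = transpose-q p q
... | no m≢p with m ≟ q
...   | yes refl = transpose-p p q
...   | no m≢q   = transpose-fix m≢p m≢q

transpose-injective : ∀ p q {m m'} → transpose p q m ≡ transpose p q m' → m ≡ m'
transpose-injective p q {m} {m'} e =
  trans (≡.sym (transpose-involutive p q m)) (trans (cong (transpose p q) e) (transpose-involutive p q m'))

transpose-< : ∀ {p q m n} → p < n → q < n → m < n → transpose p q m < n
transpose-< {p} {q} {m} p<n q<n m<n with m ≟ p
... | yes _ = q<n
... | no _ with m ≟ q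
...   | yes _ = p<n
...   | no _  = m<n

-- A blob cycle read as the sequence at 0, at 1, …, at k = at 0 of its vertices, so that positions
-- can be shifted and compared in ℕ.
record BlobSeq (G : Graph) (k s : ℕ) : Set where
  field
    at           : ℕ → Vertex G
    at-injective : InjectiveBelow k at
    at-step      : ∀ {m} → m < k → Adj G (at m) (at (suc m))
    at-closes    : at k ≡ at 0
    at-clique    : ∀ {m m'} → m < s → m' < s → m ≢ m' → Adj G (at m) (at m')
    s≤k          : s ≤ k
    3≤k          : 3 ≤ k

open BlobSeq

OnSeq : BlobSeq G k s → Pred (Vertex G) _
OnSeq {k = k} V u = ∃ λ m → m < k × at V m ≡ u

OnBlob : BlobSeq G k s → Pred (Vertex G) _
OnBlob {s = s} V u = ∃ λ m → m < s × at V m ≡ u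

toBlobCycle : BlobSeq G (suc k) s → BlobCycle G (suc k) s
toBlobCycle {G} {k} V = record
  { vtx      = at V ∘ toℕ
  ; vtx-inj  = λ e → toℕ-injective (at-injective V (toℕ<n _) (toℕ<n _) e)
  ; length≥3 = 3≤k V
  ; cycle    = edge
  ; blob≤k   = s≤k V
  ; clique   = λ i j i<s j<s i≢j → at-clique V i<s j<s (i≢j ∘ toℕ-injective)
  }
  where
  edge : ∀ i j → Consecutive i j → Adj G (at V (toℕ i)) (at V (toℕ j))
  edge i j (inj₁ i+1≡j) = subst (Adj G (at V (toℕ i)) ∘ at V) i+1≡j (at-step V (toℕ<n i))
  edge i j (inj₂ (i≡k , j≡0)) = subst₂ (λ a b → Adj G (at V a) (at V b)) (≡.sym i≡k) (≡.sym j≡0)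
    (subst (Adj G (at V k)) (at-closes V) (at-step V ≤-refl))

toBlobCycle-vertices : (V : BlobSeq G (suc k) s) → InCycle (toBlobCycle V) ≐ OnSeq V
toBlobCycle-vertices V =
  (λ (i , e) → toℕ i , toℕ<n i , e) ,
  (λ (m , m<k , e) → fromℕ< m<k , trans (cong (at V) (toℕ-fromℕ< m<k)) e)

toBlobCycle-blob : (V : BlobSeq G (suc k) s) → InBlob (toBlobCycle V) ⊆ OnBlob V
toBlobCycle-blob V (i , i<s , e) = toℕ i , i<s , e

module _ (C : BlobCycle G (suc k) s) where
  private
    index : ℕ → Fin (suc k)
    index m = fromℕ< (m%n<n m (suc k))

    toℕ-index : ∀ m → toℕ (index m) ≡ m % suc k
    toℕ-index m = toℕ-fromℕ< (m%n<n m (suc k))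

    toℕ-index-< : ∀ {m} → m < suc k → toℕ (index m) ≡ m
    toℕ-index-< {m} m< = trans (toℕ-index m) (m<n⇒m%n≡m m<)

    index-injective : InjectiveBelow (suc k) index
    index-injective m< m'< e = trans (≡.sym (toℕ-index-< m<)) (trans (cong toℕ e) (toℕ-index-< m'<))

    index-toℕ : ∀ i → index (toℕ i) ≡ i
    index-toℕ i = toℕ-injective (toℕ-index-< (toℕ<n i))

    index-wraps : index (suc k) ≡ index 0
    index-wraps = toℕ-injective
      (trans (toℕ-index (suc k)) (trans (n%n≡0 (suc k)) (≡.sym (toℕ-index-< z<s))))

    index-step : ∀ {m} → m < suc k → Consecutive (index m) (index (suc m))
    index-step {m} m< with m≤n⇒m<n∨m≡n m<
    ... | inj₁ m+1< = inj₁ (trans (cong suc (toℕ-index-< m<)) (≡.sym (toℕ-index-< m+1<)))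
    ... | inj₂ m+1≡ = inj₂ (trans (toℕ-index-< m<) (suc-injective m+1≡) ,
                            trans (toℕ-index (suc m)) (trans (cong (_% suc k) m+1≡) (n%n≡0 (suc k))))

    inBlob : ∀ {m} → m < s → toℕ (index m) < s
    inBlob m<s = subst (_< s) (≡.sym (toℕ-index-< (<-≤-trans m<s (blob≤k C)))) m<s

  fromBlobCycle : BlobSeq G (suc k) s
  fromBlobCycle = record
    { at           = vtx C ∘ index
    ; at-injective = λ m< m'< e → index-injective m< m'< (vtx-inj C e)
    ; at-step      = λ m< → cycle C _ _ (index-step m<)
    ; at-closes    = cong (vtx C) index-wraps
    ; at-clique    = λ m<s m'<s m≢m' → clique C _ _ (inBlob m<s) (inBlob m'<s)
                       (m≢m' ∘ index-injective (<-≤-trans m<s (blob≤k C)) (<-≤-trans m'<s (blob≤k C)))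
    ; s≤k          = blob≤k C
    ; 3≤k          = length≥3 C
    }

  fromBlobCycle-at-toℕ : ∀ i → at fromBlobCycle (toℕ i) ≡ vtx C i
  fromBlobCycle-at-toℕ i = cong (vtx C) (index-toℕ i)

  fromBlobCycle-vertices : OnSeq fromBlobCycle ≐ InCycle C
  fromBlobCycle-vertices =
    (λ (m , _ , e) → index m , e) ,
    (λ (i , e) → toℕ i , toℕ<n i , trans (fromBlobCycle-at-toℕ i) e)

  fromBlobCycle-blob : OnBlob fromBlobCycle ⊆ InBlob C
  fromBlobCycle-blob (m , m<s , e) = index m , inBlob m<s , e

Extension : BlobSeq G k s → Vertex G → Set
Extension {G} {k} {s} V v = ∃ λ s' → s ∸ 2 ≤ s' × Σ (BlobSeq G (suc k) s') λ V' →
  (OnSeq V' ≐ (_≡ v) ∪ OnSeq V) × (OnBlob V' ⊆ OnBlob V)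

extension-of-rearrangement : {V W : BlobSeq G k s} {v : Vertex G} →
  OnSeq W ≐ OnSeq V → OnBlob W ⊆ OnBlob V → Extension W v → Extension V v
extension-of-rearrangement (W⊆V , V⊆W) blobW⊆blobV (s' , s∸2≤s' , V' , (V'⊆ , ⊆V') , blobV'⊆) =
  s' , s∸2≤s' , V' , (Sum.map₂ W⊆V ∘ V'⊆ , ⊆V' ∘ Sum.map₂ V⊆W) , blobW⊆blobV ∘ blobV'⊆

module _ (V : BlobSeq G k s) {v : Vertex G} (v∉V : v ∉ OnSeq V) {a : ℕ} (a<k : a < k)
         (v~a : Adj G v (at V a)) (v~a+1 : Adj G v (at V (suc a)))
         {s' : ℕ} (s'≤s : s' ≤ s) (s'≤a+1 : s' ≤ suc a) where
  private
    below : ∀ {m} → m < s' → insertAt (suc a) v (at V) m ≡ at V m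
    below m<s' = insertAt-< v (at V) (<-≤-trans m<s' s'≤a+1)

  insertVertex : BlobSeq G (suc k) s'
  insertVertex = record
    { at           = insertAt (suc a) v (at V)
    ; at-injective = insertAt-injective (at-injective V) (λ m<k e → v∉V (_ , m<k , e)) a<k
    ; at-step      = insertAt-step (Adj G) (at-step V) a<k (Adj-sym G v~a) v~a+1
    ; at-closes    = trans (insertAt-> v (at V) a<k) (at-closes V)
    ; at-clique    = λ m<s' m'<s' m≢m' → subst₂ (Adj G) (≡.sym (below m<s')) (≡.sym (below m'<s'))
                       (at-clique V (<-≤-trans m<s' s'≤s) (<-≤-trans m'<s' s'≤s) m≢m')
    ; s≤k          = ≤-trans s'≤s (m≤n⇒m≤1+n (s≤k V))
    ; 3≤k          = m≤n⇒m≤1+n (3≤k V)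
    }

  insertVertex-vertices : OnSeq insertVertex ≐ (_≡ v) ∪ OnSeq V
  insertVertex-vertices = new⊆ , ⊆new
    where
    new⊆ : OnSeq insertVertex ⊆ (_≡ v) ∪ OnSeq V
    new⊆ (m , m< , e) with insertAt-image v (at V) a<k m<
    ... | inj₁ ≡v              = inj₁ (trans (≡.sym e) ≡v)
    ... | inj₂ (j , j<k , ≡aj) = inj₂ (j , j<k , trans (≡.sym ≡aj) e)

    ⊆new : (_≡ v) ∪ OnSeq V ⊆ OnSeq insertVertex
    ⊆new (inj₁ refl) = suc a , s≤s a<k , insertAt-≡ (suc a) v (at V)
    ⊆new (inj₂ (j , j<k , e)) with j <? suc a
    ... | yes j≤a = j , m≤n⇒m≤1+n j<k , trans (insertAt-< v (at V) j≤a) e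
    ... | no j≰a  = suc j , s≤s j<k , trans (insertAt-> v (at V) (≮⇒≥ j≰a)) e

  insertVertex-extension : s ∸ 2 ≤ s' → Extension V v
  insertVertex-extension s∸2≤s' = s' , s∸2≤s' , insertVertex , insertVertex-vertices ,
    λ (m , m<s' , e) → m , <-≤-trans m<s' s'≤s , trans (≡.sym (below m<s')) e

Interior : ℕ → ℕ → Set
Interior s m = 0 < m × suc m < s

-- Exchanging two interior blob positions keeps every cycle edge: an edge meeting them lies in
-- the blob clique, and the blob ends still meet the rest of the cycle.
module _ (V : BlobSeq G k s) {p q : ℕ} (p-int : Interior s p) (q-int : Interior s q) where
  private
    p<s : p < s
    p<s = <-trans (n<1+n p) (proj₂ p-int)

    q<s : q < s
    q<s = <-trans (n<1+n q) (proj₂ q-int)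

    transpose-<k : ∀ {m} → m < k → transpose p q m < k
    transpose-<k = transpose-< (<-≤-trans p<s (s≤k V)) (<-≤-trans q<s (s≤k V))

    fixed-beyond : ∀ {n} → s ≤ suc n → transpose p q n ≡ n
    fixed-beyond s≤n+1 = transpose-fix (>⇒≢ (≤-pred (<-≤-trans (proj₂ p-int) s≤n+1)))
                                       (>⇒≢ (≤-pred (<-≤-trans (proj₂ q-int) s≤n+1)))

    step : ∀ {m} → m < k → Adj G (at V (transpose p q m)) (at V (transpose p q (suc m)))
    step {m} m<k with suc m <? s
    ... | yes m+1<s = at-clique V (transpose-< p<s q<s (<-trans (n<1+n m) m+1<s))
                        (transpose-< p<s q<s m+1<s) (<⇒≢ (n<1+n m) ∘ transpose-injective p q)
    ... | no m+1≮s = subst₂ (λ a b → Adj G (at V a) (at V b))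
                       (≡.sym (fixed-beyond (≮⇒≥ m+1≮s)))
                       (≡.sym (fixed-beyond (m≤n⇒m≤1+n (≮⇒≥ m+1≮s))))
                       (at-step V m<k)

  swapPositions : BlobSeq G k s
  swapPositions = record
    { at           = at V ∘ transpose p q
    ; at-injective = λ m< m'< → transpose-injective p q ∘ at-injective V (transpose-<k m<) (transpose-<k m'<)
    ; at-step      = step
    ; at-closes    = trans (cong (at V) (fixed-beyond (m≤n⇒m≤1+n (s≤k V))))
                       (trans (at-closes V)
                              (cong (at V) (≡.sym (transpose-fix (<⇒≢ (proj₁ p-int)) (<⇒≢ (proj₁ q-int))))))
    ; at-clique    = λ m<s m'<s m≢m' → at-clique V (transpose-< p<s q<s m<s) (transpose-< p<s q<s m'<s)
                       (m≢m' ∘ transpose-injective p q)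
    ; s≤k          = s≤k V
    ; 3≤k          = 3≤k V
    }

  swapPositions-vertices : OnSeq swapPositions ≐ OnSeq V
  swapPositions-vertices =
    (λ (m , m<k , e) → transpose p q m , transpose-<k m<k , e) ,
    (λ (m , m<k , e) → transpose p q m , transpose-<k m<k ,
                       trans (cong (at V) (transpose-involutive p q m)) e)

  swapPositions-blob : OnBlob swapPositions ⊆ OnBlob V
  swapPositions-blob (m , m<s , e) = transpose p q m , transpose-< p<s q<s m<s , e

extendOutsideBlob : (V : BlobSeq G k s) {v : Vertex G} → v ∉ OnSeq V → ∀ {a} → s ≤ suc a → a < k →
  Adj G v (at V a) → Adj G v (at V (suc a)) → Extension V v
extendOutsideBlob {s = s} V v∉V s≤a+1 a<k v~a v~a+1 =
  insertVertex-extension V v∉V a<k v~a v~a+1 ≤-refl s≤a+1 (m∸n≤m s 2)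

extendThroughBlob : ∀ {t} (V : BlobSeq G k (2 + t)) {v : Vertex G} → v ∉ OnSeq V →
  ∀ {x y} → 0 < x → x < y → y ≤ t → Adj G v (at V x) → Adj G v (at V y) → Extension V v
extendThroughBlob {t = zero} V v∉V 0<x (s≤s _) ()
extendThroughBlob {G} {k} {t = suc t} V {v} v∉V {x} {y} 0<x x<y y≤t+1 v~x v~y =
  extension-of-rearrangement {V = V} {W = V₂} V₂-vertices V₂-blob
    (insertVertex-extension V₂ v∉V₂ t<k (subst (Adj G v) at₂-t v~x) (subst (Adj G v) at₂-t+1 v~y)
       (m≤n+m (suc t) 2) ≤-refl ≤-refl)
  where
  x<t+1 : x < suc t
  x<t+1 = <-≤-trans x<y y≤t+1

  y-int : Interior (3 + t) y
  y-int = <-trans 0<x x<y , s≤s (s≤s y≤t+1)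

  last-int : Interior (3 + t) (suc t)
  last-int = z<s , ≤-refl

  x-int : Interior (3 + t) x
  x-int = 0<x , s≤s (s≤s (<⇒≤ x<t+1))

  t-int : Interior (3 + t) t
  t-int = <-≤-trans 0<x (≤-pred x<t+1) , n≤1+n _

  V₁ V₂ : BlobSeq G k (3 + t)
  V₁ = swapPositions V y-int last-int
  V₂ = swapPositions V₁ x-int t-int

  at₂-t : at V x ≡ at V₂ t
  at₂-t = cong (at V) (≡.sym (trans (cong (transpose y (suc t)) (transpose-q x t))
                                    (transpose-fix (<⇒≢ x<y) (<⇒≢ x<t+1))))

  at₂-t+1 : at V y ≡ at V₂ (suc t)
  at₂-t+1 = cong (at V) (≡.sym (trans (cong (transpose y (suc t)) (transpose-fix (>⇒≢ x<t+1) 1+n≢n))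
                                      (transpose-q y (suc t))))

  V₂-vertices : OnSeq V₂ ≐ OnSeq V
  V₂-vertices = ≐-trans (swapPositions-vertices V₁ x-int t-int) (swapPositions-vertices V y-int last-int)

  V₂-blob : OnBlob V₂ ⊆ OnBlob V
  V₂-blob = swapPositions-blob V y-int last-int ∘ swapPositions-blob V₁ x-int t-int

  v∉V₂ : v ∉ OnSeq V₂
  v∉V₂ = v∉V ∘ proj₁ V₂-vertices

  t<k : t < k
  t<k = ≤-trans (m≤n+m (suc t) 2) (s≤k V)

isNeighbourAt : BlobSeq G k s → Vertex G → ℕ → Bool
isNeighbourAt {G} V v m = adj G v (at V m)

few-neighbours : ∀ ℓ t r b c d → 4 + 2 * ℓ ≤ t → c ≤ 1 → (d + b) + (d + b) ≤ 3 + r →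
  ¬ suc (t + suc r) ≤ 2 * (b + (c + d) + ℓ)
few-neighbours ℓ t r b c d t≥ c≤1 d+b≤ k≤ = 1+n≰n (begin
  suc (5 + r + 2 * ℓ)                    ≡⟨ reorder₁ ℓ r ⟩
  suc (4 + 2 * ℓ + suc r)                ≤⟨ s≤s (+-monoˡ-≤ (suc r) t≥) ⟩
  suc (t + suc r)                        ≤⟨ k≤ ⟩
  2 * (b + (c + d) + ℓ)                  ≡⟨ reorder₂ ℓ b c d ⟩
  (c + c) + ((d + b) + (d + b)) + 2 * ℓ  ≤⟨ +-monoˡ-≤ (2 * ℓ) (+-mono-≤ (+-mono-≤ c≤1 c≤1) d+b≤) ⟩
  5 + r + 2 * ℓ                          ∎)
  where
  open ≤-Reasoning
  reorder₁ : ∀ ℓ r → suc (5 + r + 2 * ℓ) ≡ suc (4 + 2 * ℓ + suc r)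
  reorder₁ = solve-∀
  reorder₂ : ∀ ℓ b c d → 2 * (b + (c + d) + ℓ) ≡ (c + c) + ((d + b) + (d + b)) + 2 * ℓ
  reorder₂ = solve-∀

module _ {ℓ t : ℕ} (t≥ : 4 + 2 * ℓ ≤ t) (V : BlobSeq G k (2 + t))
         {v : Vertex G} (v∉V : v ∉ OnSeq V) where
  private
    nbr : ℕ → Bool
    nbr = isNeighbourAt V v

    r : ℕ
    r = k ∸ (2 + t)

    k≡ : k ≡ suc (t + suc r)
    k≡ = trans (≡.sym (m+[n∸m]≡n (s≤k V))) (cong suc (≡.sym (+-suc t r)))

    -- the arc of positions t + 1, …, k, the last one being position 0 again
    arc : ℕ → Bool
    arc i = nbr (suc t + i)

    count-nbr : count nbr k ≡ indicator (nbr 0) + (count (nbr ∘ suc) t + count arc (suc r))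
    count-nbr = trans (cong (count nbr) k≡)
                      (cong (indicator (nbr 0) +_) (count-+ (nbr ∘ suc) t (suc r)))

    count-arc : count arc (suc (suc r)) ≡ count arc (suc r) + indicator (nbr 0)
    count-arc = trans (count-snoc arc (suc r))
      (cong (λ u → count arc (suc r) + indicator (adj G v u))
            (trans (cong (at V) (≡.sym k≡)) (at-closes V)))

  many-neighbours⇒extension : k ≤ 2 * (count (isNeighbourAt V v) k + ℓ) → Extension V v
  many-neighbours⇒extension many with twoTrue⊎count≤1 (nbr ∘ suc) t
  ... | inj₁ (i , j , i<j , j<t , v~i , v~j) = extendThroughBlob V v∉V z<s (s≤s i<j) j<t v~i v~j
  ... | inj₂ inner≤1 with adjacentTrue⊎sparse arc (suc (suc r))
  ...   | inj₁ (i , i+1<r+2 , v~i , v~i+1) =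
            extendOutsideBlob V v∉V (s≤s (s≤s (m≤m+n t i)))
              (subst (suc (t + i) <_) (≡.sym k≡) (s≤s (+-monoʳ-< t (≤-pred i+1<r+2))))
              v~i (subst (λ m → Adj G v (at V (suc m))) (+-suc t i) v~i+1)
  ...   | inj₂ sparse = ⊥-elim (few-neighbours ℓ t r (indicator (nbr 0)) (count (nbr ∘ suc) t)
                          (count arc (suc r)) t≥ inner≤1 (subst (λ n → n + n ≤ 3 + r) count-arc sparse)
                          (subst₂ _≤_ k≡ (cong (λ n → 2 * (n + ℓ)) count-nbr) many))

extendBlobCycle : ∀ {ℓ t} → 4 + 2 * ℓ ≤ t →
    (G : Graph) (k : ℕ) (C : BlobCycle G k (2 + t)) (v : Vertex G) →
    ¬ InCycle C v →
    k ≤ 2 * (nbrsOn C v + ℓ) →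
    Σ ℕ λ s' → Σ (BlobCycle G (suc k) s') λ C' →
    (t ≤ s')
    × (∀ u → InCycle C' u → (u ≡ v) ⊎ InCycle C u)
    × (∀ u → (u ≡ v) ⊎ InCycle C u → InCycle C' u)
    × (∀ u → InBlob C' u → InBlob C u)
extendBlobCycle t≥ G zero C with length≥3 C
... | ()
extendBlobCycle {ℓ} {t} t≥ G (suc k) C v v∉C many
  with many-neighbours⇒extension t≥ V (v∉C ∘ proj₁ (fromBlobCycle-vertices C))
         (subst (λ n → suc k ≤ 2 * (n + ℓ)) nbrsOn≡count many)
  where
  V : BlobSeq G (suc k) (2 + t)
  V = fromBlobCycle C

  nbrsOn≡count : nbrsOn C v ≡ count (isNeighbourAt V v) (suc k)
  nbrsOn≡count = length-filterᵇ-tabulate (λ i → adj G v (vtx C i)) (λ i → i) (isNeighbourAt V v)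
                   (λ i → cong (adj G v) (fromBlobCycle-at-toℕ C i))
... | s' , t≤s' , V' , (V'⊆ , ⊆V') , blobV'⊆ =
  s' , toBlobCycle V' , t≤s' ,
  (λ u → Sum.map₂ (proj₁ (fromBlobCycle-vertices C)) ∘ V'⊆ ∘ proj₁ (toBlobCycle-vertices V')) ,
  (λ u → proj₂ (toBlobCycle-vertices V') ∘ ⊆V' ∘ Sum.map₂ (proj₂ (fromBlobCycle-vertices C))) ,
  (λ u → fromBlobCycle-blob C ∘ blobV'⊆ ∘ toBlobCycle-blob V')

lemma5p5 : (ℓ : ℕ) → Σ ℕ λ s →
    (G : Graph) (k : ℕ) (C : BlobCycle G k s) (v : Vertex G) →
    ¬ InCycle C v →
    k ≤ 2 * (nbrsOn C v + ℓ) →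
    Σ ℕ λ s' → Σ (BlobCycle G (suc k) s') λ C' →
    (s ∸ 2 ≤ s')
    × (∀ u → InCycle C' u → (u ≡ v) ⊎ InCycle C u)
    × (∀ u → (u ≡ v) ⊎ InCycle C u → InCycle C' u)
    × (∀ u → InBlob C' u → InBlob C u)
lemma5p5 ℓ = 2 + (4 + 2 * ℓ) , extendBlobCycle ≤-refl
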